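{- Let $n$ be an odd integer, $p'$ a prime divisor of $n$ and $A=L(n;p')$. Let $p$ be a prime divisor of $n$ which is coprime to $n'=n/p$. Then $S(n')\subseteq f(A)$, where $f:\mathbb{Z}_n\to\mathbb{Z}_{n'}$ is the natural map.
   Context: $\mathbb{Z}_m=\mathbb{Z}/m\mathbb{Z}$, $U(m)$ its unit group; the natural map is reduction modulo $n'$. For odd $m=\prod p_i^{r_i}$ and $a\in U(m)$, the Jacobi symbol is $\left(\frac{a}{m}\right)=\prod_i\left(\frac{a\bmod p_i}{p_i}\right)^{r_i}$, and for a prime $p\mid m$, $\left(\frac{a}{p}\right)$ is the Legendre symbol of $a\bmod p$. $S(m)$ is the kernel of $a\mapsto\left(\frac{a}{m}\right)$ on $U(m)$, and $L(m;p')=\{a\in U(m): \left(\frac{a}{m}\right)=\left(\frac{a}{p'}\right)\}$. -}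

module Defs where

open import Data.Nat using (ℕ; zero; suc; _*_; _<_; _≡ᵇ_)
open import Data.Nat.DivMod using (_%_; _/_)
open import Data.Nat.Divisibility using (_∣?_)
open import Data.Nat.Primality using (prime?)
open import Data.Nat.Coprimality using (Coprime)
open import Data.Integer using (ℤ; +_; -[1+_]; _^_) renaming (_*_ to _*ℤ_)
open import Data.List using (List; upTo; foldr; map)
open import Data.Bool.ListAction using (any)
open import Data.Bool using (if_then_else_)
open import Data.Product using (_×_)
open import Relation.Binary.PropositionalEquality using (_≡_)
open import Relation.Nullary.Decidable using (does)

-- Legendre symbol (a/p) for a prime p: +1 if a is a square modulo p, -1 otherwise.
-- (Only ever applied to a coprime to p, where this is the usual Legendre symbol.)
legendre : ℕ → ℕ → ℤ
legendre a zero    = + 1   -- junk value, p = 0 is never prime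
legendre a (suc k) =
  if any (λ x → ((x * x) % suc k) ≡ᵇ (a % suc k)) (upTo (suc k))
  then + 1 else -[1+ 0 ]

-- p-adic valuation of m (with fuel; fuel m suffices for p ≥ 2, m ≥ 1)
val′ : ℕ → ℕ → ℕ → ℕ
val′ zero     p       m       = 0
val′ (suc f)  zero    m       = 0
val′ (suc f)  (suc q) zero    = 0
val′ (suc f)  (suc q) (suc m) =
  if does (suc q ∣? suc m) then suc (val′ f (suc q) (suc m / suc q)) else 0

val : ℕ → ℕ → ℕ
val p m = val′ m p m

jacobi : ℕ → ℕ → ℤ
jacobi a m = foldr _*ℤ_ (+ 1) (map factor (upTo (suc m)))
  where
  factor : ℕ → ℤ
  factor p = if does (prime? p) then
               (if does (p ∣? m) then legendre a p ^ val p m else + 1)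
             else + 1

-- U(m), with elements of ℤ_m represented by their least residues 0 ≤ a < m
U : ℕ → ℕ → Set
U m a = a < m × Coprime a m

S : ℕ → ℕ → Set
S m a = U m a × jacobi a m ≡ + 1

L : ℕ → ℕ → ℕ → Set
L m p′ a = U m a × jacobi a m ≡ legendre a p′

{-# OPTIONS --safe #-}
module Submission where

-- Write n = n′ p. Since p ∤ n′, the Jacobi symbol is multiplicative in the modulus,
-- (a/n) = (a/n′)(a/p), and (a/n′) only depends on a mod n′. Hence every a ≡ b (mod n′)
-- with (b/n′) = 1 has (a/n) = (a/p). If p′ = p every such a lies in A. Otherwise p′ ∣ n′,
-- so (a/p′) = (b/p′), and by the Chinese remainder theorem we can take a ≡ r (mod p) for an
-- r with (r/p) = (b/p′): as p is odd, squaring on ℤ_p is not injective (1² = (−1)²), so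
-- ℤ_p contains nonsquares as well as squares.

open import Defs
open import Data.Nat
  using (ℕ; zero; suc; _+_; _*_; _≡ᵇ_; _<_; _≤_; _≤′_; ≤′-refl; ≤′-step; s≤s; z<s; _≟_;
         NonZero; >-nonZero; nonTrivial⇒n>1)
import Data.Nat.Properties as ℕ
open import Data.Nat.DivMod
  using (_%_; _/_; m%n<n; m<n⇒m%n≡m; m*n%n≡0; m*n/n≡m; m/n<m; *-/-assoc; [m+kn]%n≡m%n;
         %-distribˡ-*; %-remove-+ˡ; %-remove-+ʳ; m∣n⇒o%n%m≡o%m)
open import Data.Nat.Divisibility
  using (_∣_; _∣?_; _∣0; ∣-refl; ∣-trans; ∣⇒≤; ∣m⇒∣m*n; ∣n⇒∣m*n; n∣m*n; m∣m*n; %-presˡ-∣)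
open import Data.Nat.Primality
  using (Prime; prime?; euclidsLemma; prime⇒nonZero; prime⇒nonTrivial; prime⇒irreducible)
open import Data.Nat.Coprimality using (Coprime; coprime-Bézout; coprime-divisor)
import Data.Nat.Coprimality as Coprime
open import Data.Nat.GCD using (module Bézout)
open import Data.Nat.Tactic.RingSolver using (solve-∀)
open import Data.Integer using (ℤ; +_; -[1+_]; _^_) renaming (_*_ to _*ℤ_)
import Data.Integer.Properties as ℤ
open import Data.Bool using (true; false; T; if_then_else_)
open import Data.Bool.ListAction using (any)
open import Data.Bool.Properties using (if-eta)
open import Data.Fin using (Fin; toℕ; fromℕ; fromℕ<; punchOut)
import Data.Fin.Properties as Fin
open import Data.List using (foldr; map; upTo; _∷ʳ_)
open import Data.List.Properties using (upTo-∷ʳ; map-++; foldr-∷ʳ; foldr-fusion)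
open import Data.List.Membership.Propositional using (lose; find)
open import Data.List.Membership.Propositional.Properties using (∈-upTo⁺; ∈-upTo⁻)
open import Data.List.Relation.Unary.Any.Properties using (any⁺; any⁻)
open import Data.Product using (Σ; ∃; _×_; _,_; proj₁; proj₂)
open import Data.Sum using (_⊎_; inj₁; inj₂)
open import Data.Unit using (tt)
open import Data.Empty using (⊥-elim)
open import Function using (_∘_; _∘′_)
open import Function.Definitions using (Injective)
open import Algebra.Properties.CommutativeSemigroup ℤ.*-commutativeSemigroup using (xy∙z≈xz∙y)
open import Relation.Binary.PropositionalEquality
open import Relation.Nullary using (¬_; Dec; yes; no; does)
open import Relation.Nullary.Decidable using (dec-true; dec-false)
open import Relation.Nullary.Negation using (contradiction)

prime>1 : ∀ {p} → Prime p → 1 < p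
prime>1 {p} p-prime = nonTrivial⇒n>1 p {{prime⇒nonTrivial p-prime}}

prime∣prime⇒≡ : ∀ {q p} → Prime q → Prime p → q ∣ p → q ≡ p
prime∣prime⇒≡ q-prime p-prime q∣p with prime⇒irreducible p-prime q∣p
... | inj₁ refl = contradiction (prime>1 q-prime) (ℕ.<-irrefl refl)
... | inj₂ q≡p  = q≡p

prime∣m*p⇒∣m : ∀ {q m p} → Prime q → Prime p → q ≢ p → q ∣ m * p → q ∣ m
prime∣m*p⇒∣m {m = m} q-prime p-prime q≢p q∣mp with euclidsLemma m _ q-prime q∣mp
... | inj₁ q∣m = q∣m
... | inj₂ q∣p = contradiction (prime∣prime⇒≡ q-prime p-prime q∣p) q≢p

coprime⇒prime∤ : ∀ {p m} → Prime p → Coprime p m → ¬ p ∣ m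
coprime⇒prime∤ p-prime p⊥m p∣m = ℕ.<⇒≢ (prime>1 p-prime) (sym (p⊥m (∣-refl , p∣m)))

prime∣odd⇒>2 : ∀ {m p} → Prime p → m * p % 2 ≡ 1 → 2 < p
prime∣odd⇒>2 {m} p-prime odd = ℕ.≤∧≢⇒< (prime>1 p-prime) λ where
  refl → contradiction (trans (sym (m*n%n≡0 m 2)) odd) λ ()

coprime-%⁻ : ∀ {a m} .{{_ : NonZero m}} → Coprime (a % m) m → Coprime a m
coprime-%⁻ a%m⊥m (d∣a , d∣m) = a%m⊥m (%-presˡ-∣ d∣a d∣m , d∣m)

coprime-* : ∀ {a m n} → Coprime a m → Coprime a n → Coprime a (m * n)
coprime-* {m = m} {n} a⊥m a⊥n {d} (d∣a , d∣mn) =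
  a⊥m (d∣a , coprime-divisor d⊥n (subst (d ∣_) (ℕ.*-comm m n) d∣mn))
  where
  d⊥n : Coprime d n
  d⊥n (e∣d , e∣n) = a⊥n (∣-trans e∣d d∣a , e∣n)

prime⇒∈U : ∀ {p r} → Prime p → 0 < r → r < p → U p r
prime⇒∈U p-prime 0<r r<p = r<p , Coprime.sym (Coprime.prime⇒coprime p-prime {{>-nonZero 0<r}} r<p)

%-*-unit : ∀ {w n} x .{{_ : NonZero n}} → w % n ≡ 1 % n → x * w % n ≡ x % n
%-*-unit {w} {n} x w≡1 = begin
  x * w % n                 ≡⟨ %-distribˡ-* x w n ⟩
  (x % n) * (w % n) % n     ≡⟨ cong (λ t → (x % n) * t % n) w≡1 ⟩
  (x % n) * (1 % n) % n     ≡⟨ %-distribˡ-* x 1 n ⟨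
  x * 1 % n                 ≡⟨ cong (_% n) (ℕ.*-identityʳ x) ⟩
  x % n                     ∎
  where open ≡-Reasoning

coprime⇒inverse : ∀ {m n} .{{_ : NonZero n}} → Coprime m n → ∃ λ u → u * m % n ≡ 1 % n
coprime⇒inverse {m} {n@(suc c)} m⊥n with coprime-Bézout m⊥n
... | Bézout.+- x y 1+yn≡xm = x , trans (cong (_% n) (sym 1+yn≡xm)) ([m+kn]%n≡m%n 1 y n)
-- here x m ≡ −1, so (n − 1) x inverts m
... | Bézout.-+ x y 1+xm≡yn = c * x , (begin
  c * x * m % n                 ≡⟨ [m+kn]%n≡m%n (c * x * m) 1 n ⟨
  (c * x * m + 1 * n) % n       ≡⟨ cong (_% n) (shift x y c m) ⟩
  (c * (1 + x * m) + 1) % n     ≡⟨ cong (λ t → (c * t + 1) % n) 1+xm≡yn ⟩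
  (c * (y * n) + 1) % n         ≡⟨ cong (_% n) (regroup c y) ⟩
  (1 + c * y * n) % n           ≡⟨ [m+kn]%n≡m%n 1 (c * y) n ⟩
  1 % n                         ∎)
  where
  open ≡-Reasoning
  shift : ∀ x y c m → c * x * m + 1 * suc c ≡ c * (1 + x * m) + 1
  shift = solve-∀
  regroup : ∀ c y → c * (y * suc c) + 1 ≡ 1 + c * y * suc c
  regroup = solve-∀

crt : ∀ {m n b r} .{{_ : NonZero m}} .{{_ : NonZero n}} → Coprime m n → b < m → r < n →
      ∃ λ a → a < m * n × a % m ≡ b × a % n ≡ r
crt {m} {n} {b} {r} m⊥n b<m r<n = a₀ % (m * n) , m%n<n a₀ (m * n) , a≡b , a≡r
  where
  instance mn≢0 = ℕ.m*n≢0 m n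
  u⁻¹ = coprime⇒inverse m⊥n
  v⁻¹ = coprime⇒inverse (Coprime.sym m⊥n)
  -- v n ≡ 1 (mod m) and u m ≡ 1 (mod n)
  a₀ = b * (proj₁ v⁻¹ * n) + r * (proj₁ u⁻¹ * m)
  a≡b : a₀ % (m * n) % m ≡ b
  a≡b = begin
    a₀ % (m * n) % m            ≡⟨ m∣n⇒o%n%m≡o%m m (m * n) a₀ (m∣m*n n) ⟩
    a₀ % m                      ≡⟨ %-remove-+ʳ _ (∣n⇒∣m*n r (n∣m*n (proj₁ u⁻¹))) ⟩
    b * (proj₁ v⁻¹ * n) % m     ≡⟨ %-*-unit b (proj₂ v⁻¹) ⟩
    b % m                       ≡⟨ m<n⇒m%n≡m b<m ⟩
    b                           ∎
    where open ≡-Reasoning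
  a≡r : a₀ % (m * n) % n ≡ r
  a≡r = begin
    a₀ % (m * n) % n            ≡⟨ m∣n⇒o%n%m≡o%m n (m * n) a₀ (n∣m*n m) ⟩
    a₀ % n                      ≡⟨ %-remove-+ˡ _ (∣n⇒∣m*n b (n∣m*n (proj₁ v⁻¹))) ⟩
    r * (proj₁ u⁻¹ * m) % n     ≡⟨ %-*-unit r (proj₂ u⁻¹) ⟩
    r % n                       ≡⟨ m<n⇒m%n≡m r<n ⟩
    r                           ∎
    where open ≡-Reasoning

crt-U : ∀ {m n b r} .{{_ : NonZero m}} .{{_ : NonZero n}} → Coprime m n → U m b → U n r →
        ∃ λ a → U (m * n) a × a % m ≡ b × a % n ≡ r
crt-U {m} {n} m⊥n (b<m , b⊥m) (r<n , r⊥n) with a , a<mn , a≡b , a≡r ← crt m⊥n b<m r<n =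
  a , (a<mn , coprime-* (coprime-%⁻ (subst (λ x → Coprime x m) (sym a≡b) b⊥m))
                        (coprime-%⁻ (subst (λ x → Coprime x n) (sym a≡r) r⊥n))) , a≡b , a≡r

∏ : ℕ → (ℕ → ℤ) → ℤ
∏ n F = foldr _*ℤ_ (+ 1) (map F (upTo n))

∏-suc : ∀ n F → ∏ (suc n) F ≡ ∏ n F *ℤ F n
∏-suc n F = begin
  ∏ (suc n) F                      ≡⟨ cong (foldr _*ℤ_ (+ 1) ∘′ map F) (upTo-∷ʳ n) ⟨
  foldr _*ℤ_ (+ 1) (map F (upTo n ∷ʳ n))
                                   ≡⟨ cong (foldr _*ℤ_ (+ 1)) (map-++ F (upTo n) _) ⟩
  foldr _*ℤ_ (+ 1) (xs ∷ʳ F n)     ≡⟨ foldr-∷ʳ _*ℤ_ (+ 1) (F n) xs ⟩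
  foldr _*ℤ_ (F n *ℤ + 1) xs       ≡⟨ cong (λ e → foldr _*ℤ_ e xs) (ℤ.*-comm (F n) (+ 1)) ⟩
  foldr _*ℤ_ (+ 1 *ℤ F n) xs       ≡⟨ foldr-fusion (_*ℤ F n) (+ 1) (λ x y → ℤ.*-assoc x y _) xs ⟨
  ∏ n F *ℤ F n                     ∎
  where
  open ≡-Reasoning
  xs = map F (upTo n)

∏-cong : ∀ n {F G} → (∀ i → i < n → F i ≡ G i) → ∏ n F ≡ ∏ n G
∏-cong zero    F≗G = refl
∏-cong (suc n) {F} {G} F≗G = begin
  ∏ (suc n) F    ≡⟨ ∏-suc n F ⟩
  ∏ n F *ℤ F n   ≡⟨ cong₂ _*ℤ_ (∏-cong n (λ i → F≗G i ∘ ℕ.m<n⇒m<1+n)) (F≗G n (ℕ.n<1+n n)) ⟩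
  ∏ n G *ℤ G n   ≡⟨ ∏-suc n G ⟨
  ∏ (suc n) G    ∎
  where open ≡-Reasoning

∏-extend : ∀ {m N} F → m ≤ N → (∀ i → m ≤ i → F i ≡ + 1) → ∏ N F ≡ ∏ m F
∏-extend {m} F m≤N F≡1 = go (ℕ.≤⇒≤′ m≤N)
  where
  go : ∀ {N} → m ≤′ N → ∏ N F ≡ ∏ m F
  go ≤′-refl                = refl
  go (≤′-step {n} m≤′n) = begin
    ∏ (suc n) F      ≡⟨ ∏-suc n F ⟩
    ∏ n F *ℤ F n     ≡⟨ cong (∏ n F *ℤ_) (F≡1 n (ℕ.≤′⇒≤ m≤′n)) ⟩
    ∏ n F *ℤ + 1     ≡⟨ ℤ.*-identityʳ (∏ n F) ⟩
    ∏ n F            ≡⟨ go m≤′n ⟩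
    ∏ m F            ∎
    where open ≡-Reasoning

∏-extract : ∀ {n k F G} → k < n → (∀ i → i ≢ k → F i ≡ G i) → G k ≡ + 1 →
            ∏ n F ≡ ∏ n G *ℤ F k
∏-extract {suc n} {k} {F} {G} k<1+n F≗G Gk≡1 with ℕ.m<1+n⇒m<n∨m≡n k<1+n
... | inj₁ k<n = begin
  ∏ (suc n) F              ≡⟨ ∏-suc n F ⟩
  ∏ n F *ℤ F n             ≡⟨ cong₂ _*ℤ_ (∏-extract k<n F≗G Gk≡1) (F≗G n (ℕ.>⇒≢ k<n)) ⟩
  ∏ n G *ℤ F k *ℤ G n      ≡⟨ xy∙z≈xz∙y (∏ n G) (F k) (G n) ⟩
  ∏ n G *ℤ G n *ℤ F k      ≡⟨ cong (_*ℤ F k) (∏-suc n G) ⟨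
  ∏ (suc n) G *ℤ F k       ∎
  where open ≡-Reasoning
... | inj₂ refl = begin
  ∏ (suc k) F              ≡⟨ ∏-suc k F ⟩
  ∏ k F *ℤ F k             ≡⟨ cong (_*ℤ F k) (∏-cong k (λ i i<k → F≗G i (ℕ.<⇒≢ i<k))) ⟩
  ∏ k G *ℤ F k             ≡⟨ cong (_*ℤ F k) (ℤ.*-identityʳ (∏ k G)) ⟨
  ∏ k G *ℤ + 1 *ℤ F k      ≡⟨ cong (λ x → ∏ k G *ℤ x *ℤ F k) Gk≡1 ⟨
  ∏ k G *ℤ G k *ℤ F k      ≡⟨ cong (_*ℤ F k) (∏-suc k G) ⟨
  ∏ (suc k) G *ℤ F k       ∎
  where open ≡-Reasoning

val′-∣ : ∀ f {q m} .{{_ : NonZero q}} .{{_ : NonZero m}} → q ∣ m →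
         val′ (suc f) q m ≡ suc (val′ f q (m / q))
val′-∣ f {suc q} {suc m} q∣m rewrite dec-true (suc q ∣? suc m) q∣m = refl

val′-∤ : ∀ f {q m} → ¬ q ∣ m → val′ f q m ≡ 0
val′-∤ zero          q∤m = refl
val′-∤ (suc f) {zero}  q∤m = refl
val′-∤ (suc f) {suc q} {zero}  q∤m = contradiction (suc q ∣0) q∤m
val′-∤ (suc f) {suc q} {suc m} q∤m rewrite dec-false (suc q ∣? suc m) q∤m = refl

val′-zero : ∀ f q → val′ f q 0 ≡ 0
val′-zero zero    q       = refl
val′-zero (suc f) zero    = refl
val′-zero (suc f) (suc q) = refl

val′-fuel : ∀ {f g q m} → 1 < q → m ≤ f → m ≤ g → val′ f q m ≡ val′ g q m
val′-fuel {f} {g} {q} {zero} _ _ _ = trans (val′-zero f q) (sym (val′-zero g q))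
val′-fuel {suc f} {suc g} {q@(suc _)} {m@(suc _)} q>1 m≤1+f m≤1+g with q ∣? m
... | yes q∣m = begin
  val′ (suc f) q m         ≡⟨ val′-∣ f q∣m ⟩
  suc (val′ f q (m / q))   ≡⟨ cong suc (val′-fuel q>1 (m/q≤ m≤1+f) (m/q≤ m≤1+g)) ⟩
  suc (val′ g q (m / q))   ≡⟨ val′-∣ g q∣m ⟨
  val′ (suc g) q m         ∎
  where
  open ≡-Reasoning
  m/q≤ : ∀ {n} → m ≤ suc n → m / q ≤ n
  m/q≤ m≤1+n = ℕ.≤-pred (ℕ.<-≤-trans (m/n<m m q q>1) m≤1+n)
... | no q∤m = trans (val′-∤ (suc f) q∤m) (sym (val′-∤ (suc g) q∤m))

val′-*-coprime : ∀ f {q c m} → Prime q → ¬ q ∣ c → val′ f q (c * m) ≡ val′ f q m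
val′-*-coprime zero q-prime q∤c = refl
val′-*-coprime (suc f) {q} {c} {zero} q-prime q∤c = cong (val′ (suc f) q) (ℕ.*-zeroʳ c)
val′-*-coprime (suc f) {c = zero} {suc m} q-prime q∤c = contradiction (_ ∣0) q∤c
val′-*-coprime (suc f) {q} {c@(suc _)} {m@(suc _)} q-prime q∤c with q ∣? m
... | yes q∣m = begin
  val′ (suc f) q (c * m)         ≡⟨ val′-∣ f (∣n⇒∣m*n c q∣m) ⟩
  suc (val′ f q (c * m / q))     ≡⟨ cong (suc ∘′ val′ f q) (*-/-assoc c q∣m) ⟩
  suc (val′ f q (c * (m / q)))   ≡⟨ cong suc (val′-*-coprime f q-prime q∤c) ⟩
  suc (val′ f q (m / q))         ≡⟨ val′-∣ f q∣m ⟨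
  val′ (suc f) q m               ∎
  where
  open ≡-Reasoning
  instance q≢0 = prime⇒nonZero q-prime
... | no q∤m = trans (val′-∤ (suc f) q∤cm) (sym (val′-∤ (suc f) q∤m))
  where
  q∤cm : ¬ q ∣ c * m
  q∤cm q∣cm with euclidsLemma c m q-prime q∣cm
  ... | inj₁ q∣c = q∤c q∣c
  ... | inj₂ q∣m = q∤m q∣m

val-*-coprime : ∀ {q c m} → Prime q → ¬ q ∣ c → val q (c * m) ≡ val q m
val-*-coprime {c = zero}  q-prime q∤c = contradiction (_ ∣0) q∤c
val-*-coprime {q} {c@(suc _)} {m} q-prime q∤c = begin
  val′ (c * m) q (c * m)   ≡⟨ val′-*-coprime (c * m) q-prime q∤c ⟩
  val′ (c * m) q m         ≡⟨ val′-fuel (prime>1 q-prime) (ℕ.m≤n*m m c) ℕ.≤-refl ⟩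
  val′ m q m               ∎
  where open ≡-Reasoning

val-*-self : ∀ {p m} → Prime p → ¬ p ∣ m → val p (m * p) ≡ 1
val-*-self {p} {zero}  p-prime p∤m = contradiction (_ ∣0) p∤m
val-*-self {p} {m@(suc _)} p-prime p∤m = begin
  val′ (m * p) p (m * p)               ≡⟨ val′-fuel (prime>1 p-prime) ℕ.≤-refl (ℕ.n≤1+n _) ⟩
  val′ (suc (m * p)) p (m * p)         ≡⟨ val′-∣ (m * p) (n∣m*n m) ⟩
  suc (val′ (m * p) p (m * p / p))     ≡⟨ cong (suc ∘′ val′ (m * p) p) (m*n/n≡m m p) ⟩
  suc (val′ (m * p) p m)               ≡⟨ cong suc (val′-∤ (m * p) p∤m) ⟩
  1                                    ∎
  where
  open ≡-Reasoning
  instance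
    p≢0 = prime⇒nonZero p-prime
    mp≢0 = ℕ.m*n≢0 m p

legendre-±1 : ∀ a p → legendre a p ≡ + 1 ⊎ legendre a p ≡ -[1+ 0 ]
legendre-±1 a zero    = inj₁ refl
legendre-±1 a (suc k) with any (λ x → x * x % suc k ≡ᵇ a % suc k) (upTo (suc k))
... | true  = inj₁ refl
... | false = inj₂ refl

legendre-cong : ∀ p .{{_ : NonZero p}} {a c} → a % p ≡ c % p → legendre a p ≡ legendre c p
legendre-cong (suc k) a≡c rewrite a≡c = refl

legendre-% : ∀ {a q m} .{{_ : NonZero m}} → q ∣ m → legendre (a % m) q ≡ legendre a q
legendre-% {a} {zero}  {m} q∣m = refl
legendre-% {a} {suc k} {m} q∣m = legendre-cong (suc k) {a % m} {a} (m∣n⇒o%n%m≡o%m (suc k) m a q∣m)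

legendre-square : ∀ {p r} .{{_ : NonZero p}} x → x < p → x * x % p ≡ r % p → legendre r p ≡ + 1
legendre-square {suc k} {r} x x<p x²≡r
  with any (λ x → x * x % suc k ≡ᵇ r % suc k) (upTo (suc k)) in isSquare
... | true  = refl
... | false = ⊥-elim (subst T isSquare (any⁺ _ (lose (∈-upTo⁺ x<p) (ℕ.≡⇒≡ᵇ _ _ x²≡r))))

legendre-nonsquare : ∀ {p r} .{{_ : NonZero p}} → (∀ x → x < p → x * x % p ≢ r % p) →
                     legendre r p ≡ -[1+ 0 ]
legendre-nonsquare {suc k} {r} ¬square
  with any (λ x → x * x % suc k ≡ᵇ r % suc k) (upTo (suc k)) in isSquare
... | false = refl
... | true with x , x∈ , x²≡r ← find (any⁻ _ _ (subst T (sym isSquare) tt)) =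
  contradiction (ℕ.≡ᵇ⇒≡ _ _ x²≡r) (¬square x (∈-upTo⁻ x∈))

nonInjective⇒nonSurjective : ∀ {n} (f : Fin n → Fin n) {i j} → i ≢ j → f i ≡ f j →
                             ∃ λ y → ∀ x → f x ≢ y
nonInjective⇒nonSurjective {suc m} f {i} {j} i≢j fi≡fj
  with Fin.all? (λ y → Fin.any? (λ x → f x Fin.≟ y))
... | no ¬onto
  with y , ¬hit ← Fin.¬∀⟶∃¬ (suc m) _ (λ y → Fin.any? (λ x → f x Fin.≟ y)) ¬onto
  = y , λ x fx≡y → ¬hit (x , fx≡y)
... | yes onto = contradiction (Fin.injective⇒≤ h-injective) ℕ.1+n≰n
  where
  g : Fin (suc m) → Fin (suc m)
  g y = proj₁ (onto y)
  f∘g : ∀ y → f (g y) ≡ y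
  f∘g y = proj₂ (onto y)
  g-injective : Injective _≡_ _≡_ g
  g-injective {y₁} {y₂} gy₁≡gy₂ = trans (sym (f∘g y₁)) (trans (cong f gy₁≡gy₂) (f∘g y₂))
  -- i and j have the same image, so at most one of them is g (f i)
  missed : ∃ λ z → f z ≡ f i × z ≢ g (f i)
  missed with i Fin.≟ g (f i)
  ... | yes i≡gfi = j , sym fi≡fj , λ j≡gfi → i≢j (trans i≡gfi (sym j≡gfi))
  ... | no  i≢gfi = i , refl , i≢gfi
  z = proj₁ missed
  z≢g : ∀ y → z ≢ g y
  z≢g y z≡gy = proj₂ (proj₂ missed) (trans z≡gy (cong g y≡fi))
    where
    y≡fi : y ≡ f i
    y≡fi = trans (sym (f∘g y)) (trans (cong f (sym z≡gy)) (proj₁ (proj₂ missed)))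
  h : Fin (suc m) → Fin m
  h y = punchOut (z≢g y)
  h-injective : Injective _≡_ _≡_ h
  h-injective hy₁≡hy₂ = g-injective (Fin.punchOut-injective (z≢g _) (z≢g _) hy₁≡hy₂)

square : ∀ {n} .{{_ : NonZero n}} → Fin n → Fin n
square {n} x = fromℕ< (m%n<n (toℕ x * toℕ x) n)

toℕ-square : ∀ {n} .{{_ : NonZero n}} (x : Fin n) → toℕ (square x) ≡ toℕ x * toℕ x % n
toℕ-square {n} x = Fin.toℕ-fromℕ< (m%n<n (toℕ x * toℕ x) n)

nonsquare : ∀ {p} → 2 < p → ∃ λ r → 0 < r × r < p × legendre r p ≡ -[1+ 0 ]
nonsquare {p} (s≤s (s≤s (s≤s {n = k} _))) =
  r , 0<r , Fin.toℕ<n y , legendre-nonsquare {r = r} r-nonsquare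
  where
  one top : Fin p
  one = Fin.suc Fin.zero
  top = fromℕ (suc (suc k))
  [p-1]²≡1 : ∀ k → (2 + k) * (2 + k) ≡ 1 + (1 + k) * (3 + k)
  [p-1]²≡1 = solve-∀
  one≢top : one ≢ top
  one≢top 1≡p-1 with () ← trans (cong toℕ 1≡p-1) (Fin.toℕ-fromℕ (suc (suc k)))
  square-one≡top : square one ≡ square top
  square-one≡top = Fin.toℕ-injective (begin
    toℕ (square one)                      ≡⟨ toℕ-square one ⟩
    1 % p                                 ≡⟨ [m+kn]%n≡m%n 1 (suc k) p ⟨
    (1 + suc k * p) % p                   ≡⟨ cong (_% p) ([p-1]²≡1 k) ⟨
    (suc (suc k) * suc (suc k)) % p       ≡⟨ cong (λ t → t * t % p) (Fin.toℕ-fromℕ (suc (suc k))) ⟨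
    toℕ top * toℕ top % p                 ≡⟨ toℕ-square top ⟨
    toℕ (square top)                      ∎)
    where open ≡-Reasoning
  gap = nonInjective⇒nonSurjective square one≢top square-one≡top
  y = proj₁ gap
  y∉image = proj₂ gap
  r = toℕ y
  0<r : 0 < r
  0<r = ℕ.n≢0⇒n>0 {r} λ r≡0 →
    y∉image Fin.zero (trans square-zero (sym (Fin.toℕ-injective r≡0)))
    where
    square-zero : square {p} Fin.zero ≡ Fin.zero
    square-zero = Fin.toℕ-injective (toℕ-square {p} Fin.zero)
  r-nonsquare : ∀ x → x < p → x * x % p ≢ r % p
  r-nonsquare x x<p x²≡r = y∉image x′ (Fin.toℕ-injective (begin
    toℕ (square x′)             ≡⟨ toℕ-square x′ ⟩
    toℕ x′ * toℕ x′ % p         ≡⟨ cong (λ t → t * t % p) (Fin.toℕ-fromℕ< x<p) ⟩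
    x * x % p                   ≡⟨ x²≡r ⟩
    r % p                       ≡⟨ m<n⇒m%n≡m {m = r} (Fin.toℕ<n y) ⟩
    r                           ∎))
    where
    open ≡-Reasoning
    x′ = fromℕ< x<p

legendre-onto : ∀ {p} → 2 < p → ∀ {ε} → ε ≡ + 1 ⊎ ε ≡ -[1+ 0 ] →
                ∃ λ r → 0 < r × r < p × legendre r p ≡ ε
legendre-onto {suc _} 2<p (inj₁ refl) = 1 , z<s , 1<p , legendre-square {r = 1} 1 1<p refl
  where 1<p = ℕ.<-trans (ℕ.n<1+n 1) 2<p
legendre-onto 2<p (inj₂ refl) = nonsquare 2<p

-- The local factor of Defs.jacobi, so that jacobi a m is ∏ (suc m) (jacobiFactor a m) by definition.
jacobiFactor : ℕ → ℕ → ℕ → ℤ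
jacobiFactor a m q =
  if does (prime? q) then (if does (q ∣? m) then legendre a q ^ val q m else + 1) else + 1

jacobiFactor-∣ : ∀ {a m q} → Prime q → q ∣ m → jacobiFactor a m q ≡ legendre a q ^ val q m
jacobiFactor-∣ {m = m} {q} q-prime q∣m
  rewrite dec-true (prime? q) q-prime | dec-true (q ∣? m) q∣m = refl

jacobiFactor-∤ : ∀ {a m q} → ¬ q ∣ m → jacobiFactor a m q ≡ + 1
jacobiFactor-∤ {m = m} {q} q∤m rewrite dec-false (q ∣? m) q∤m = if-eta (does (prime? q))

jacobi-% : ∀ {a m} .{{_ : NonZero m}} → jacobi (a % m) m ≡ jacobi a m
jacobi-% {a} {m} = ∏-cong (suc m) (λ q _ → factor-% q)
  where
  factor-% : ∀ q → jacobiFactor (a % m) m q ≡ jacobiFactor a m q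
  factor-% q with prime? q | q ∣? m
  ... | yes _ | yes q∣m = cong (_^ val q m) (legendre-% q∣m)
  ... | yes _ | no _    = refl
  ... | no _  | _       = refl

jacobi-*-prime : ∀ {a m p} .{{_ : NonZero m}} → Prime p → ¬ p ∣ m →
                 jacobi a (m * p) ≡ jacobi a m *ℤ legendre a p
jacobi-*-prime {a} {m} {p} p-prime p∤m = begin
  ∏ (suc (m * p)) (jacobiFactor a (m * p))
    ≡⟨ ∏-extract p<1+mp factor-≢p (jacobiFactor-∤ p∤m) ⟩
  ∏ (suc (m * p)) (jacobiFactor a m) *ℤ jacobiFactor a (m * p) p
    ≡⟨ cong₂ _*ℤ_ (∏-extend _ m<1+mp factor->) factor-p ⟩
  ∏ (suc m) (jacobiFactor a m) *ℤ legendre a p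
    ∎
  where
  open ≡-Reasoning
  instance p≢0 = prime⇒nonZero p-prime
  p<1+mp : p < suc (m * p)
  p<1+mp = s≤s (ℕ.m≤n*m p m)
  m<1+mp : suc m ≤ suc (m * p)
  m<1+mp = s≤s (ℕ.m≤m*n m p)
  factor-> : ∀ q → suc m ≤ q → jacobiFactor a m q ≡ + 1
  factor-> q m<q = jacobiFactor-∤ (λ q∣m → ℕ.<⇒≱ m<q (∣⇒≤ q∣m))
  factor-p : jacobiFactor a (m * p) p ≡ legendre a p
  factor-p = begin
    jacobiFactor a (m * p) p         ≡⟨ jacobiFactor-∣ p-prime (n∣m*n m) ⟩
    legendre a p ^ val p (m * p)     ≡⟨ cong (legendre a p ^_) (val-*-self p-prime p∤m) ⟩
    legendre a p ^ 1                 ≡⟨ ℤ.^-identityʳ (legendre a p) ⟩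
    legendre a p                     ∎
  factor-≢p : ∀ q → q ≢ p → jacobiFactor a (m * p) q ≡ jacobiFactor a m q
  factor-≢p q q≢p with prime? q | q ∣? m | q ∣? m * p
  ... | yes q-prime | yes q∣m | yes _    = cong (legendre a q ^_) (begin
    val q (m * p)   ≡⟨ cong (val q) (ℕ.*-comm m p) ⟩
    val q (p * m)   ≡⟨ val-*-coprime q-prime (q≢p ∘ prime∣prime⇒≡ q-prime p-prime) ⟩
    val q m         ∎)
  ... | yes _       | yes q∣m | no q∤mp  = contradiction (∣m⇒∣m*n p q∣m) q∤mp
  ... | yes q-prime | no q∤m  | yes q∣mp =
    contradiction (prime∣m*p⇒∣m q-prime p-prime q≢p q∣mp) q∤m
  ... | yes _       | no _    | no _     = refl
  ... | no _        | _       | _        = refl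

jacobi-*-prime-S : ∀ {a b m p} .{{_ : NonZero m}} → Prime p → ¬ p ∣ m → a % m ≡ b →
                   jacobi b m ≡ + 1 → jacobi a (m * p) ≡ legendre a p
jacobi-*-prime-S {a} {b} {m} {p} p-prime p∤m a≡b jacobi-b≡1 = begin
  jacobi a (m * p)                 ≡⟨ jacobi-*-prime p-prime p∤m ⟩
  jacobi a m *ℤ legendre a p       ≡⟨ cong (_*ℤ legendre a p) jacobi-a≡1 ⟩
  + 1 *ℤ legendre a p              ≡⟨ ℤ.*-identityˡ (legendre a p) ⟩
  legendre a p                     ∎
  where
  open ≡-Reasoning
  jacobi-a≡1 : jacobi a m ≡ + 1
  jacobi-a≡1 = trans (sym jacobi-%) (trans (cong (λ x → jacobi x m) a≡b) jacobi-b≡1)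

lemma3p3 : (n p′ p n′ : ℕ) → n % 2 ≡ 1 → Prime p′ → p′ ∣ n → Prime p → n ≡ n′ * p
    → .{{_ : NonZero n′}} → Coprime p n′
    → (b : ℕ) → S n′ b → Σ ℕ (λ a → L n p′ a × a % n′ ≡ b)
lemma3p3 .(n′ * p) p′ p n′ odd p′-prime p′∣n p-prime refl p⊥n′ b (b∈U , jacobi-b≡1)
  with r , 0<r , r<p , r≡b ← legendre-onto (prime∣odd⇒>2 {n′} p-prime odd) (legendre-±1 b p′)
  with a , a∈U , a≡b , a≡r ← crt-U {{_}} {{prime⇒nonZero p-prime}} (Coprime.sym p⊥n′) b∈U
                                    (prime⇒∈U p-prime 0<r r<p)
  = a , (a∈U , jacobi-a≡legendre (p′ ≟ p)) , a≡b
  where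
  instance p≢0 = prime⇒nonZero p-prime
  jacobi-a≡legendre-p : jacobi a (n′ * p) ≡ legendre a p
  jacobi-a≡legendre-p = jacobi-*-prime-S p-prime (coprime⇒prime∤ p-prime p⊥n′) a≡b jacobi-b≡1
  jacobi-a≡legendre : Dec (p′ ≡ p) → jacobi a (n′ * p) ≡ legendre a p′
  jacobi-a≡legendre (yes refl) = jacobi-a≡legendre-p
  jacobi-a≡legendre (no p′≢p)  = begin
    jacobi a (n′ * p)    ≡⟨ jacobi-a≡legendre-p ⟩
    legendre a p         ≡⟨ legendre-cong p (trans a≡r (sym (m<n⇒m%n≡m r<p))) ⟩
    legendre r p         ≡⟨ r≡b ⟩
    legendre b p′        ≡⟨ cong (λ x → legendre x p′) a≡b ⟨
    legendre (a % n′) p′ ≡⟨ legendre-% (prime∣m*p⇒∣m p′-prime p-prime p′≢p p′∣n) ⟩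
    legendre a p′        ∎
    where open ≡-Reasoning
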